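{- Let $G$ be a nut graph on $n$ vertices and let $v$ be a vertex of $G$ of degree $\rho$. Then there exists a nut graph $G'$ on $n+2\rho$ vertices. Moreover, if $G$ is regular, then $G'$ can be taken to be regular.
   Context: All graphs are finite and simple. For a graph $G$ with 0--1 adjacency matrix $\mathbf{A}(G)$, the nullity is the multiplicity of $0$ as an eigenvalue of $\mathbf{A}(G)$. A vertex is a core vertex if it corresponds to a nonzero entry of some vector in $\ker \mathbf{A}(G)$; a core graph is a singular graph all of whose vertices are core vertices; a nut graph is a core graph of nullity one. -}

module Defs where

open import Data.Nat using (ℕ; zero; suc)
import Data.Nat as ℕ
open import Data.Fin using (Fin; zero; suc)
open import Data.Bool using (Bool; true; false; if_then_else_)
open import Data.Rational using (ℚ; 0ℚ; 1ℚ; _+_; _*_)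
open import Data.Product using (Σ; ∃; _×_; _,_)
open import Relation.Binary.PropositionalEquality using (_≡_)
open import Relation.Nullary using (¬_)

record Graph (n : ℕ) : Set where
  field
    adj   : Fin n → Fin n → Bool
    sym   : ∀ i j → adj i j ≡ adj j i
    loopless : ∀ i → adj i i ≡ false
open Graph public

sumℚ : ∀ {n} → (Fin n → ℚ) → ℚ
sumℚ {zero} f = 0ℚ
sumℚ {suc n} f = f zero + sumℚ (λ i → f (suc i))

sumℕ : ∀ {n} → (Fin n → ℕ) → ℕ
sumℕ {zero} f = 0
sumℕ {suc n} f = f zero ℕ.+ sumℕ (λ i → f (suc i))

A : ∀ {n} → Graph n → Fin n → Fin n → ℚ
A G i j = if adj G i j then 1ℚ else 0ℚ

degree : ∀ {n} → Graph n → Fin n → ℕ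
degree G v = sumℕ (λ j → if adj G v j then 1 else 0)

Regular : ∀ {n} → Graph n → Set
Regular {n} G = ∃ λ k → ∀ (v : Fin n) → degree G v ≡ k

InKernel : ∀ {n} → Graph n → (Fin n → ℚ) → Set
InKernel G x = ∀ i → sumℚ (λ j → A G i j * x j) ≡ 0ℚ

NonzeroVec : ∀ {n} → (Fin n → ℚ) → Set
NonzeroVec {n} x = ∃ λ (i : Fin n) → ¬ (x i ≡ 0ℚ)

NullityOne : ∀ {n} → Graph n → Set
NullityOne {n} G = Σ (Fin n → ℚ) λ x →
  InKernel G x × NonzeroVec x ×
  (∀ y → InKernel G y → ∃ λ (c : ℚ) → ∀ i → y i ≡ c * x i)

CoreVertex : ∀ {n} → Graph n → Fin n → Set
CoreVertex G v = ∃ λ x → InKernel G x × ¬ (x v ≡ 0ℚ)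

Nut : ∀ {n} → Graph n → Set
Nut {n} G = NullityOne G × (∀ (v : Fin n) → CoreVertex G v)

module Submission where

-- Let v be a vertex of G with neighbours u₀, …, u_{r-1} (r = deg v).  The graph
-- G' on n + 2r vertices keeps the old vertices, deletes the edges at v, adds new
-- vertices p₀, …, p_{r-1} and q₀, …, q_{r-1}, and joins v to every p_k, q_k to
-- u_k, and p_i to q_k whenever i ≠ k.  The map
--     lift x = (x off v,  (1 - r)·x(v) at v,  x(u_k) at p_k,  x(v) at q_k)
-- sends ker A(G) into ker A(G'), and every kernel vector of G' is the lift of
-- its restriction to the old vertices (with v given the common value on the
-- q_k), which lies in ker A(G).  Hence nullity one transfers; full support
-- transfers too, because a nowhere-zero kernel vector forces r ≠ 1.  Degrees
-- are unchanged on old vertices and equal r on new ones, so regularity is kept.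

open import Defs hiding (sym)
import Data.Nat as ℕ
open ℕ using (ℕ; zero; suc)
import Data.Nat.Properties as ℕP
open import Data.Fin using (Fin; zero; suc; _↑ˡ_; _↑ʳ_; splitAt)
open import Data.Fin.Properties using (_≟_; splitAt-↑ˡ; splitAt-↑ʳ; join-splitAt)
open import Data.Bool using (Bool; true; false; if_then_else_; not; _∨_)
open import Data.Bool.Properties using (if-swap-then; if-float; if-eta; ∨-comm)
open import Data.Sum using (inj₁; inj₂; [_,_]′)
open import Data.Product using (Σ; _×_; _,_; ∃; proj₁; proj₂)
open import Data.Empty using (⊥-elim)
open import Data.Rational using (ℚ; 0ℚ; 1ℚ)
import Data.Rational.Properties as QP
open import Data.Rational.Solver using (module +-*-Solver)
open +-*-Solver using (solve; _:+_; _:*_; _:-_; :-_; _:=_; con)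
open import Relation.Nullary using (does; yes; no; ¬_)
open import Relation.Nullary.Decidable using (dec-true; dec-false)
import Relation.Binary.PropositionalEquality
open import Relation.Binary.PropositionalEquality using (_≡_; refl; sym; trans; cong; cong₂; subst)
open Relation.Binary.PropositionalEquality.≡-Reasoning
open import Algebra.Structures using (IsCommutativeMonoid)
open import Function using (_∘_)

does-≟-sym : ∀ {n} (a b : Fin n) → does (a ≟ b) ≡ does (b ≟ a)
does-≟-sym a b with a ≟ b | b ≟ a
... | yes _   | yes _   = refl
... | no _    | no _    = refl
... | yes a≡b | no b≢a  = ⊥-elim (b≢a (sym a≡b))
... | no a≢b  | yes b≡a = ⊥-elim (a≢b (sym b≡a))

if-true : ∀ {A : Set} {b : Bool} {x y : A} → b ≡ true → (if b then x else y) ≡ x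
if-true refl = refl

if-false : ∀ {A : Set} {b : Bool} {x y : A} → b ≡ false → (if b then x else y) ≡ y
if-false refl = refl

if-not : ∀ {A : Set} (b : Bool) {x y : A} → (if not b then x else y) ≡ (if b then y else x)
if-not true  = refl
if-not false = refl

count : ∀ {n} → (Fin n → Bool) → ℕ
count f = sumℕ (λ j → if f j then 1 else 0)

enum : ∀ {n} (f : Fin n → Bool) → Fin (count f) → Fin n
enum {suc n} f k with f zero
... | true  = case k
  where
  case : Fin (suc (count (f ∘ suc))) → Fin (suc n)
  case zero    = zero
  case (suc k) = suc (enum (f ∘ suc) k)
... | false = suc (enum (f ∘ suc) k)

enum-member : ∀ {n} (f : Fin n → Bool) k → f (enum f k) ≡ true
enum-member {suc n} f k with f zero in f₀
enum-member {suc n} f zero    | true  = f₀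
enum-member {suc n} f (suc k) | true  = enum-member (f ∘ suc) k
enum-member {suc n} f k       | false = enum-member (f ∘ suc) k

record SumOperator (C : Set) : Set where
  infixl 6 _∙_
  field
    ε                   : C
    _∙_                 : C → C → C
    isCommutativeMonoid : IsCommutativeMonoid _≡_ _∙_ ε
    ∑                   : ∀ {n} → (Fin n → C) → C
    ∑-zero              : (f : Fin 0 → C) → ∑ f ≡ ε
    ∑-suc               : ∀ {n} (f : Fin (suc n) → C) → ∑ f ≡ f zero ∙ ∑ (f ∘ suc)

ℚ-sums : SumOperator ℚ
ℚ-sums = record
  { isCommutativeMonoid = QP.+-0-isCommutativeMonoid
  ; ∑ = sumℚ ; ∑-zero = λ _ → refl ; ∑-suc = λ _ → refl }

ℕ-sums : SumOperator ℕ
ℕ-sums = record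
  { isCommutativeMonoid = ℕP.+-0-isCommutativeMonoid
  ; ∑ = sumℕ ; ∑-zero = λ _ → refl ; ∑-suc = λ _ → refl }

module FiniteSum {C : Set} (S : SumOperator C) where
  open SumOperator S public
  open IsCommutativeMonoid isCommutativeMonoid using (identityˡ; identityʳ; assoc; comm)

  ∑-cong : ∀ {n} {f g : Fin n → C} → (∀ i → f i ≡ g i) → ∑ f ≡ ∑ g
  ∑-cong {zero}  {f} {g} f≗g = trans (∑-zero f) (sym (∑-zero g))
  ∑-cong {suc n} {f} {g} f≗g = trans (∑-suc f)
    (trans (cong₂ _∙_ (f≗g zero) (∑-cong (f≗g ∘ suc))) (sym (∑-suc g)))

  ∑-ε : ∀ n → ∑ {n} (λ _ → ε) ≡ ε
  ∑-ε zero    = ∑-zero _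
  ∑-ε (suc n) = trans (∑-suc _) (trans (cong (ε ∙_) (∑-ε n)) (identityˡ ε))

  ∑-split : ∀ m k (f : Fin (m ℕ.+ k) → C) → ∑ f ≡ ∑ (λ i → f (i ↑ˡ k)) ∙ ∑ (λ i → f (m ↑ʳ i))
  ∑-split zero    k f = trans (sym (identityˡ _)) (cong (_∙ ∑ f) (sym (∑-zero _)))
  ∑-split (suc m) k f = trans (∑-suc f) (trans (cong (f zero ∙_) (∑-split m k (f ∘ suc)))
    (trans (sym (assoc _ _ _)) (cong (_∙ _) (sym (∑-suc (λ i → f (i ↑ˡ k)))))))

  ∑-point : ∀ {n} (a : Fin n) (g : Fin n → C) → ∑ (λ j → if does (j ≟ a) then g j else ε) ≡ g a
  ∑-point {suc n} zero    g = trans (∑-suc _) (trans (cong (g zero ∙_) (∑-ε n)) (identityʳ _))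
  ∑-point {suc n} (suc a) g = trans (∑-suc _) (trans (identityˡ _) (∑-point a (g ∘ suc)))

  ∑-except : ∀ {n} → Fin n → (Fin n → C) → C
  ∑-except i g = ∑ (λ j → if does (j ≟ i) then ε else g j)

  ∑-except-∙ : ∀ {n} (i : Fin n) (g : Fin n → C) → ∑-except i g ∙ g i ≡ ∑ g
  ∑-except-∙ {suc n} zero    g = trans (cong (_∙ g zero) (trans (∑-suc _) (identityˡ _)))
    (trans (comm _ _) (sym (∑-suc g)))
  ∑-except-∙ {suc n} (suc i) g = trans (cong (_∙ g (suc i)) (∑-suc _)) (trans (assoc _ _ _)
    (trans (cong (g zero ∙_) (∑-except-∙ i (g ∘ suc))) (sym (∑-suc g))))

  ∑-subset : ∀ {n} (f : Fin n → Bool) (g : Fin n → C) →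
    ∑ (λ j → if f j then g j else ε) ≡ ∑ (g ∘ enum f)
  ∑-subset {zero}  f g = trans (∑-zero _) (sym (∑-zero _))
  ∑-subset {suc n} f g with f zero in f₀
  ... | true  = trans (∑-suc _)
    (trans (cong₂ _∙_ (if-true f₀) (∑-subset (f ∘ suc) (g ∘ suc))) (sym (∑-suc _)))
  ... | false = trans (∑-suc _)
    (trans (cong₂ _∙_ (if-false f₀) (∑-subset (f ∘ suc) (g ∘ suc))) (identityˡ _))

  ∑-enum-point : ∀ {n} (f : Fin n → Bool) (a : Fin n) (c : C) →
    ∑ (λ k → if does (a ≟ enum f k) then c else ε) ≡ (if f a then c else ε)
  ∑-enum-point f a c = begin
    ∑ (λ k → if does (a ≟ enum f k) then c else ε)
      ≡⟨ sym (∑-subset f (λ j → if does (a ≟ j) then c else ε)) ⟩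
    ∑ (λ j → if f j then (if does (a ≟ j) then c else ε) else ε)
      ≡⟨ ∑-cong (λ j → trans (if-swap-then (f j) (does (a ≟ j)))
                             (cong (λ b → if b then _ else ε) (does-≟-sym a j))) ⟩
    ∑ (λ j → if does (j ≟ a) then (if f j then c else ε) else ε)
      ≡⟨ ∑-point a (λ j → if f j then c else ε) ⟩
    (if f a then c else ε) ∎

module QS = FiniteSum ℚ-sums

module RationalFacts where
  open import Data.Rational using (_+_; _*_; _-_; -_; 1/_; NonZero; NonNegative; >-nonZero)

  row-as-nbhd : ∀ {m} (H : Graph m) (y : Fin m → ℚ) (i : Fin m) →
    sumℚ (λ j → A H i j * y j) ≡ sumℚ (λ j → if adj H i j then y j else 0ℚ)
  row-as-nbhd H y i = QS.∑-cong (λ j → indicator-* (adj H i j) (y j))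
    where
    indicator-* : ∀ b a → (if b then 1ℚ else 0ℚ) * a ≡ (if b then a else 0ℚ)
    indicator-* true  a = QP.*-identityˡ a
    indicator-* false a = QP.*-zeroˡ a

  ∑-scale : ∀ {m} (c : ℚ) (g : Fin m → ℚ) → sumℚ (λ j → c * g j) ≡ c * sumℚ g
  ∑-scale {zero}  c g = sym (QP.*-zeroʳ c)
  ∑-scale {suc m} c g = trans (cong (c * g zero +_) (∑-scale c (g ∘ suc))) (sym (QP.*-distribˡ-+ c _ _))

  infixr 8 _·_
  _·_ : ℕ → ℚ → ℚ
  m · a = sumℚ {m} (λ _ → a)

  ·-scale : ∀ m (c a : ℚ) → m · (c * a) ≡ c * (m · a)
  ·-scale m c a = ∑-scale {m} c (λ _ → a)

  suc·-nonzero : ∀ m {a} → ¬ a ≡ 0ℚ → ¬ suc m · a ≡ 0ℚ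
  suc·-nonzero m {a} a≢0 ma≡0 = a≢0 (begin
      a                          ≡⟨ sym (QP.*-identityʳ a) ⟩
      a * 1ℚ                     ≡⟨ cong (a *_) (sym (QP.*-inverseʳ s)) ⟩
      a * (s * 1/ s)             ≡⟨ sym (QP.*-assoc a s (1/ s)) ⟩
      (a * s) * 1/ s             ≡⟨ cong (_* 1/ s) (trans (sym a·s) ma≡0) ⟩
      0ℚ * 1/ s                  ≡⟨ QP.*-zeroˡ (1/ s) ⟩
      0ℚ ∎)
    where
    s : ℚ
    s = suc m · 1ℚ
    nonNeg : ∀ k → NonNegative (k · 1ℚ)
    nonNeg zero    = _
    nonNeg (suc k) = QP.nonNeg+nonNeg⇒nonNeg 1ℚ (k · 1ℚ) {{nonNeg k}}
    instance
      s≢0 : NonZero s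
      s≢0 = >-nonZero (QP.positive⁻¹ s {{QP.pos+nonNeg⇒pos 1ℚ (m · 1ℚ) {{nonNeg m}}}})
    a·s : suc m · a ≡ a * s
    a·s = trans (QS.∑-cong {suc m} (λ _ → sym (QP.*-identityʳ a))) (∑-scale {suc m} a (λ _ → 1ℚ))

  minus-·-nonzero : ∀ m {a} → ¬ a ≡ 0ℚ → ¬ m ≡ 1 → ¬ a - m · a ≡ 0ℚ
  minus-·-nonzero zero          {a} a≢0 _   eq = a≢0 (trans (sym (QP.+-identityʳ a)) eq)
  minus-·-nonzero (suc zero)    a≢0 m≢1 _  = m≢1 refl
  minus-·-nonzero (suc (suc m)) {a} a≢0 _ eq = suc·-nonzero m a≢0 (begin
      suc m · a                    ≡⟨ solve 2 (λ a S → S := :- (a :- (a :+ S))) refl a (suc m · a) ⟩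
      - (a - (a + suc m · a))      ≡⟨ cong -_ eq ⟩
      0ℚ ∎)

  singleton-∑-nonzero : ∀ {m} (g : Fin m → ℚ) → m ≡ 1 → (∀ k → ¬ g k ≡ 0ℚ) → ¬ sumℚ g ≡ 0ℚ
  singleton-∑-nonzero g refl g≢0 eq = g≢0 zero (trans (sym (QP.+-identityʳ _)) eq)

  -- The vector spanning the kernel of a nut graph has no zero entry: every vertex
  -- is a core vertex, and every kernel vector is a multiple of the generator.
  nut-generator-nowhere-zero : ∀ {m} (H : Graph m) (nut : Nut H) → ∀ w → ¬ proj₁ (proj₁ nut) w ≡ 0ℚ
  nut-generator-nowhere-zero H ((x , _ , _ , spans) , core) w xw≡0 with core w
  ... | y , y∈ker , yw≢0 with spans y y∈ker
  ...   | c , y≡cx = yw≢0 (trans (y≡cx w) (trans (cong (c *_) xw≡0) (QP.*-zeroʳ c)))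

  solve-for : ∀ {a e b t : ℚ} → a + e ≡ 0ℚ → e + b ≡ t → b ≡ a + t
  solve-for {a} {e} {b} {t} a+e≡0 e+b≡t = begin
    b                          ≡⟨ solve 3 (λ a e b → b := (a :+ (e :+ b)) :- (a :+ e)) refl a e b ⟩
    (a + (e + b)) - (a + e)    ≡⟨ cong₂ (λ s t → (a + s) - t) e+b≡t a+e≡0 ⟩
    (a + t) - 0ℚ               ≡⟨ QP.+-identityʳ (a + t) ⟩
    a + t ∎

open RationalFacts

module Expansion {n : ℕ} (G : Graph n) (v : Fin n) where
  open import Data.Nat using (_+_; _*_)

  isV : Fin n → Bool
  isV w = does (w ≟ v)

  isV-self : isV v ≡ true
  isV-self = dec-true (v ≟ v) refl

  isV-other : ∀ {w} → ¬ w ≡ v → isV w ≡ false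
  isV-other {w} w≢v = dec-false (w ≟ v) w≢v

  r : ℕ
  r = count (adj G v)

  u : Fin r → Fin n
  u = enum (adj G v)

  u≢v : ∀ k → ¬ u k ≡ v
  u≢v k uk≡v with trans (sym (enum-member (adj G v) k)) (trans (cong (adj G v) uk≡v) (loopless G v))
  ... | ()

  data Vertex : Set where
    old : Fin n → Vertex
    p q : Fin r → Vertex

  _~_ : Vertex → Vertex → Bool
  old a ~ old b = if isV a ∨ isV b then false else adj G a b
  old a ~ p k   = isV a
  old a ~ q k   = does (a ≟ u k)
  p k   ~ old a = isV a
  p i   ~ p k   = false
  p i   ~ q k   = not (does (i ≟ k))
  q k   ~ old a = does (a ≟ u k)
  q k   ~ p i   = not (does (i ≟ k))
  q i   ~ q k   = false

  ~-sym : ∀ κ μ → (κ ~ μ) ≡ (μ ~ κ)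
  ~-sym (old a) (old b) = cong₂ (λ s t → if s then false else t) (∨-comm (isV a) (isV b)) (Graph.sym G a b)
  ~-sym (old a) (p k)   = refl
  ~-sym (old a) (q k)   = refl
  ~-sym (p k)   (old a) = refl
  ~-sym (p i)   (p k)   = refl
  ~-sym (p i)   (q k)   = refl
  ~-sym (q k)   (old a) = refl
  ~-sym (q k)   (p i)   = refl
  ~-sym (q i)   (q k)   = refl

  ~-irrefl : ∀ κ → (κ ~ κ) ≡ false
  ~-irrefl (old a) with isV a
  ... | true  = refl
  ... | false = loopless G a
  ~-irrefl (p k) = refl
  ~-irrefl (q k) = refl

  old-cases : (P : Fin n → Set) → P v → (∀ a → ¬ a ≡ v → P a) → ∀ a → P a
  old-cases P Pv P-other a with a ≟ v
  ... | yes a≡v = subst P (sym a≡v) Pv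
  ... | no  a≢v = P-other a a≢v

  -- Vertices of G' are numbered old vertices first, then the p k, then the q k
  -- (note that 2 * r unfolds to r + (r + 0)); index and kind are inverse.
  N : ℕ
  N = n + 2 * r

  index : Vertex → Fin N
  index (old w) = w ↑ˡ (r + (r + 0))
  index (p k)   = n ↑ʳ (k ↑ˡ (r + 0))
  index (q k)   = n ↑ʳ (r ↑ʳ (k ↑ˡ 0))

  kind : Fin N → Vertex
  kind i = [ old , [ p , [ q , (λ ()) ]′ ∘ splitAt r ]′ ∘ splitAt r ]′ (splitAt n i)

  kind-index : ∀ κ → kind (index κ) ≡ κ
  kind-index (old w) = cong [ old , _ ]′ (splitAt-↑ˡ n w (r + (r + 0)))
  kind-index (p k) = trans (cong [ old , _ ]′ (splitAt-↑ʳ n (r + (r + 0)) (k ↑ˡ (r + 0))))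
                           (cong [ p , _ ]′ (splitAt-↑ˡ r k (r + 0)))
  kind-index (q k) = trans (cong [ old , _ ]′ (splitAt-↑ʳ n (r + (r + 0)) (r ↑ʳ (k ↑ˡ 0))))
                    (trans (cong [ p , _ ]′ (splitAt-↑ʳ r (r + 0) (k ↑ˡ 0)))
                           (cong [ q , _ ]′ (splitAt-↑ˡ r k 0)))

  index-kind : ∀ i → index (kind i) ≡ i
  index-kind i with splitAt n i | join-splitAt n (r + (r + 0)) i
  ... | inj₁ w | i≡w = i≡w
  ... | inj₂ j | i≡j with splitAt r j | join-splitAt r (r + 0) j
  ...   | inj₁ k | j≡k = trans (cong (n ↑ʳ_) j≡k) i≡j
  ...   | inj₂ l | j≡l with splitAt r l | join-splitAt r 0 l
  ...     | inj₁ k | l≡k = trans (cong (n ↑ʳ_) (trans (cong (r ↑ʳ_) l≡k) j≡l)) i≡j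

  G' : Graph N
  G' = record
    { adj      = λ i j → kind i ~ kind j
    ; sym      = λ i j → ~-sym (kind i) (kind j)
    ; loopless = λ i → ~-irrefl (kind i)
    }

  module Local {C : Set} (S : SumOperator C) where
    open FiniteSum S
    open IsCommutativeMonoid isCommutativeMonoid using (identityˡ; identityʳ)

    ∑V : (Vertex → C) → C
    ∑V F = ∑ (F ∘ old) ∙ (∑ (F ∘ p) ∙ ∑ (F ∘ q))

    ∑-kind : (F : Vertex → C) → ∑ (F ∘ kind) ≡ ∑V F
    ∑-kind F = begin
      ∑ (F ∘ kind)
        ≡⟨ ∑-split n (r + (r + 0)) (F ∘ kind) ⟩
      ∑ (F ∘ kind ∘ index ∘ old) ∙ ∑ (F ∘ kind ∘ (n ↑ʳ_))
        ≡⟨ cong (∑ (F ∘ kind ∘ index ∘ old) ∙_) new-part ⟩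
      ∑ (F ∘ kind ∘ index ∘ old) ∙ (∑ (F ∘ kind ∘ index ∘ p) ∙ ∑ (F ∘ kind ∘ index ∘ q))
        ≡⟨ cong₂ _∙_ (∑-cong (cong F ∘ kind-index ∘ old))
                     (cong₂ _∙_ (∑-cong (cong F ∘ kind-index ∘ p)) (∑-cong (cong F ∘ kind-index ∘ q))) ⟩
      ∑V F ∎
      where
      new-part : ∑ (F ∘ kind ∘ (n ↑ʳ_)) ≡ ∑ (F ∘ kind ∘ index ∘ p) ∙ ∑ (F ∘ kind ∘ index ∘ q)
      new-part = trans (∑-split r (r + 0) _) (cong (∑ (F ∘ kind ∘ index ∘ p) ∙_)
        (trans (∑-split r 0 _) (trans (cong (∑ (F ∘ kind ∘ index ∘ q) ∙_) (∑-zero _)) (identityʳ _))))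

    nbhd : Vertex → (Vertex → C) → C
    nbhd κ F = ∑V (λ μ → if κ ~ μ then F μ else ε)

    nbhd-G' : (F : Fin N → C) (i : Fin N) →
      ∑ (λ j → if adj G' i j then F j else ε) ≡ nbhd (kind i) (F ∘ index)
    nbhd-G' F i = trans
      (∑-cong (λ j → cong (λ t → if adj G' i j then F t else ε) (sym (index-kind j))))
      (∑-kind (λ μ → if kind i ~ μ then F (index μ) else ε))

    nbhd-cong : ∀ κ {F F′ : Vertex → C} → (∀ μ → F μ ≡ F′ μ) → nbhd κ F ≡ nbhd κ F′
    nbhd-cong κ F≗F′ = cong₂ _∙_ (∑-cong (λ w → cong (if κ ~ old w then_else ε) (F≗F′ (old w))))
      (cong₂ _∙_ (∑-cong (λ k → cong (if κ ~ p k then_else ε) (F≗F′ (p k))))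
                 (∑-cong (λ k → cong (if κ ~ q k then_else ε) (F≗F′ (q k)))))

    nbhd-v : (F : Vertex → C) → nbhd (old v) F ≡ ∑ (F ∘ p)
    nbhd-v F = begin
      nbhd (old v) F
        ≡⟨ cong₂ _∙_ (trans (∑-cong old-part) (∑-ε n))
                     (cong₂ _∙_ (∑-cong (λ k → if-true isV-self)) (trans (∑-cong q-part) (∑-ε r))) ⟩
      ε ∙ (∑ (F ∘ p) ∙ ε)
        ≡⟨ trans (identityˡ _) (identityʳ _) ⟩
      ∑ (F ∘ p) ∎
      where
      old-part : ∀ w → (if old v ~ old w then F (old w) else ε) ≡ ε
      old-part w = cong (λ b → if (if b ∨ isV w then false else adj G v w) then F (old w) else ε) isV-self
      q-part : ∀ k → (if does (v ≟ u k) then F (q k) else ε) ≡ ε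
      q-part k = if-false (dec-false (v ≟ u k) (u≢v k ∘ sym))

    nbhd-p : (F : Vertex → C) (i : Fin r) → nbhd (p i) F ≡ F (old v) ∙ ∑-except i (F ∘ q)
    nbhd-p F i = begin
      nbhd (p i) F
        ≡⟨ cong₂ _∙_ (∑-point v (F ∘ old)) (cong₂ _∙_ (∑-ε r) (∑-cong q-part)) ⟩
      F (old v) ∙ (ε ∙ ∑-except i (F ∘ q))
        ≡⟨ cong (F (old v) ∙_) (identityˡ _) ⟩
      F (old v) ∙ ∑-except i (F ∘ q) ∎
      where
      q-part : ∀ k → (if not (does (i ≟ k)) then F (q k) else ε) ≡ (if does (k ≟ i) then ε else F (q k))
      q-part k = trans (if-not (does (i ≟ k))) (cong (if_then ε else F (q k)) (does-≟-sym i k))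

    nbhd-q : (F : Vertex → C) (i : Fin r) → nbhd (q i) F ≡ F (old (u i)) ∙ ∑-except i (F ∘ p)
    nbhd-q F i = begin
      nbhd (q i) F
        ≡⟨ cong₂ _∙_ (∑-point (u i) (F ∘ old)) (cong₂ _∙_ (∑-cong (λ k → if-not (does (k ≟ i)))) (∑-ε r)) ⟩
      F (old (u i)) ∙ (∑-except i (F ∘ p) ∙ ε)
        ≡⟨ cong (F (old (u i)) ∙_) (identityʳ _) ⟩
      F (old (u i)) ∙ ∑-except i (F ∘ p) ∎

    -- For a ≠ v, the neighbourhood of a in G' is its neighbourhood in G, with v
    -- replaced by the vertices q k attached to a; when F is constant (= c) on the
    -- q k, the neighbourhood sum is the G-neighbourhood sum of F with value c at v.
    nbhd-old : ∀ {a} → ¬ a ≡ v → (F : Vertex → C) (c : C) → (∀ k → F (q k) ≡ c) →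
      nbhd (old a) F ≡ ∑ (λ w → if adj G a w then (if isV w then c else F (old w)) else ε)
    nbhd-old {a} a≢v F c Fq≡c = begin
      nbhd (old a) F
        ≡⟨ cong₂ _∙_ (∑-cong old-part)
                     (cong₂ _∙_ (trans (∑-cong (λ k → if-false (isV-other a≢v))) (∑-ε r)) q-part) ⟩
      ∑-except v g ∙ (ε ∙ g v)
        ≡⟨ cong (∑-except v g ∙_) (identityˡ _) ⟩
      ∑-except v g ∙ g v
        ≡⟨ ∑-except-∙ v g ⟩
      ∑ g ∎
      where
      g : Fin n → C
      g w = if adj G a w then (if isV w then c else F (old w)) else ε

      drop-v : ∀ w → (if (if isV w then false else adj G a w) then F (old w) else ε) ≡ (if isV w then ε else g w)
      drop-v w with isV w
      ... | true  = refl
      ... | false = refl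

      old-part : ∀ w → (if old a ~ old w then F (old w) else ε) ≡ (if isV w then ε else g w)
      old-part w = trans (cong (λ b → if (if b ∨ isV w then false else adj G a w) then F (old w) else ε)
                               (isV-other a≢v))
                         (drop-v w)

      q-part : ∑ (λ k → if does (a ≟ u k) then F (q k) else ε) ≡ g v
      q-part = begin
        ∑ (λ k → if does (a ≟ u k) then F (q k) else ε)
          ≡⟨ ∑-cong (λ k → cong (if does (a ≟ u k) then_else ε) (Fq≡c k)) ⟩
        ∑ (λ k → if does (a ≟ u k) then c else ε)
          ≡⟨ ∑-enum-point (adj G v) a c ⟩
        (if adj G v a then c else ε)
          ≡⟨ cong₂ (if_then_else ε) (Graph.sym G v a) (sym (if-true isV-self)) ⟩
        g v ∎

module ExpansionKernel {n : ℕ} (G : Graph n) (v : Fin n) where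
  open Expansion G v
  open import Data.Rational using (_+_; _*_; _-_)
  module QL = Local ℚ-sums

  nbhd-of-kernel : (y : Fin N → ℚ) → InKernel G' y → ∀ κ → QL.nbhd κ (y ∘ index) ≡ 0ℚ
  nbhd-of-kernel y y∈ker κ = begin
    QL.nbhd κ (y ∘ index)                              ≡⟨ cong (λ μ → QL.nbhd μ (y ∘ index)) (sym (kind-index κ)) ⟩
    QL.nbhd (kind (index κ)) (y ∘ index)               ≡⟨ sym (QL.nbhd-G' y (index κ)) ⟩
    sumℚ (λ j → if adj G' (index κ) j then y j else 0ℚ) ≡⟨ sym (row-as-nbhd G' y (index κ)) ⟩
    sumℚ (λ j → A G' (index κ) j * y j)                 ≡⟨ y∈ker (index κ) ⟩
    0ℚ ∎

  kernel-of-nbhd : (Y : Vertex → ℚ) → (∀ κ → QL.nbhd κ Y ≡ 0ℚ) → InKernel G' (Y ∘ kind)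
  kernel-of-nbhd Y nbhd≡0 i = begin
    sumℚ (λ j → A G' i j * Y (kind j))               ≡⟨ row-as-nbhd G' (Y ∘ kind) i ⟩
    sumℚ (λ j → if adj G' i j then Y (kind j) else 0ℚ) ≡⟨ QL.nbhd-G' (Y ∘ kind) i ⟩
    QL.nbhd (kind i) (Y ∘ kind ∘ index)             ≡⟨ QL.nbhd-cong (kind i) (cong Y ∘ kind-index) ⟩
    QL.nbhd (kind i) Y                              ≡⟨ nbhd≡0 (kind i) ⟩
    0ℚ ∎

  kernel-row : ∀ x → InKernel G x → ∀ a → sumℚ (λ j → if adj G a j then x j else 0ℚ) ≡ 0ℚ
  kernel-row x x∈ker a = trans (sym (row-as-nbhd G x a)) (x∈ker a)

  kernel-row-v : ∀ x → InKernel G x → sumℚ (x ∘ u) ≡ 0ℚ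
  kernel-row-v x x∈ker = trans (sym (QS.∑-subset (adj G v) x)) (kernel-row x x∈ker v)

  lift : (Fin n → ℚ) → Vertex → ℚ
  lift x (old w) = if isV w then x v - r · x v else x w
  lift x (p k)   = x (u k)
  lift x (q k)   = x v

  lift-v : ∀ x → lift x (old v) ≡ x v - r · x v
  lift-v x = if-true isV-self

  lift-old : ∀ x {w} → ¬ w ≡ v → lift x (old w) ≡ x w
  lift-old x w≢v = if-false (isV-other w≢v)

  module _ (x : Fin n → ℚ) (x∈ker : InKernel G x) where
    private
      at-v : QL.nbhd (old v) (lift x) ≡ 0ℚ
      at-v = trans (QL.nbhd-v (lift x)) (kernel-row-v x x∈ker)

      old-values : ∀ w → (if isV w then x v else lift x (old w)) ≡ x w
      old-values = old-cases (λ w → (if isV w then x v else lift x (old w)) ≡ x w)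
        (if-true isV-self) (λ w w≢v → trans (if-false (isV-other w≢v)) (lift-old x w≢v))

      at-old : ∀ a → ¬ a ≡ v → QL.nbhd (old a) (lift x) ≡ 0ℚ
      at-old a a≢v = begin
        QL.nbhd (old a) (lift x)
          ≡⟨ QL.nbhd-old a≢v (lift x) (x v) (λ _ → refl) ⟩
        sumℚ (λ w → if adj G a w then (if isV w then x v else lift x (old w)) else 0ℚ)
          ≡⟨ QS.∑-cong (λ w → cong (if adj G a w then_else 0ℚ) (old-values w)) ⟩
        sumℚ (λ w → if adj G a w then x w else 0ℚ)
          ≡⟨ kernel-row x x∈ker a ⟩
        0ℚ ∎

      at-p : ∀ i → QL.nbhd (p i) (lift x) ≡ 0ℚ
      at-p i = begin
        QL.nbhd (p i) (lift x)                      ≡⟨ QL.nbhd-p (lift x) i ⟩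
        lift x (old v) + E                          ≡⟨ cong₂ _+_ (lift-v x) refl ⟩
        (x v - r · x v) + E                         ≡⟨ cong (λ t → (x v - t) + E) (sym (QS.∑-except-∙ i (λ _ → x v))) ⟩
        (x v - (E + x v)) + E                       ≡⟨ solve 2 (λ a e → (a :- (e :+ a)) :+ e := con 0ℚ) refl (x v) E ⟩
        0ℚ ∎
        where E = QS.∑-except i (λ _ → x v)

      at-q : ∀ i → QL.nbhd (q i) (lift x) ≡ 0ℚ
      at-q i = begin
        QL.nbhd (q i) (lift x)                      ≡⟨ QL.nbhd-q (lift x) i ⟩
        lift x (old (u i)) + E                      ≡⟨ cong₂ _+_ (lift-old x (u≢v i)) refl ⟩
        x (u i) + E                                 ≡⟨ QP.+-comm (x (u i)) E ⟩
        E + x (u i)                                 ≡⟨ QS.∑-except-∙ i (x ∘ u) ⟩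
        sumℚ (x ∘ u)                                ≡⟨ kernel-row-v x x∈ker ⟩
        0ℚ ∎
        where E = QS.∑-except i (x ∘ u)

    lift-kernel : ∀ κ → QL.nbhd κ (lift x) ≡ 0ℚ
    lift-kernel (old a) = old-cases (λ a → QL.nbhd (old a) (lift x) ≡ 0ℚ) at-v at-old a
    lift-kernel (p i)   = at-p i
    lift-kernel (q i)   = at-q i

  module Restriction (Y : Vertex → ℚ) (nbhd≡0 : ∀ κ → QL.nbhd κ Y ≡ 0ℚ) where
    -- The common value of Y on the vertices q k.
    c : ℚ
    c = Y (old v) + sumℚ (Y ∘ q)

    restrict : Fin n → ℚ
    restrict w = if isV w then c else Y (old w)

    Yq≡c : ∀ i → Y (q i) ≡ c
    Yq≡c i = solve-for {Y (old v)} {QS.∑-except i (Y ∘ q)}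
      (trans (sym (QL.nbhd-p Y i)) (nbhd≡0 (p i))) (QS.∑-except-∙ i (Y ∘ q))

    ∑Yp≡0 : sumℚ (Y ∘ p) ≡ 0ℚ
    ∑Yp≡0 = trans (sym (QL.nbhd-v Y)) (nbhd≡0 (old v))

    Yp≡Yu : ∀ i → Y (p i) ≡ Y (old (u i))
    Yp≡Yu i = trans (solve-for {Y (old (u i))} {QS.∑-except i (Y ∘ p)}
      (trans (sym (QL.nbhd-q Y i)) (nbhd≡0 (q i))) (trans (QS.∑-except-∙ i (Y ∘ p)) ∑Yp≡0))
      (QP.+-identityʳ _)

    restrict-u : ∀ k → restrict (u k) ≡ Y (old (u k))
    restrict-u k = if-false (isV-other (u≢v k))

    restrict-kernel : InKernel G restrict
    restrict-kernel a = trans (row-as-nbhd G restrict a) (old-cases row≡0 at-v at-old a)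
      where
      row≡0 : Fin n → Set
      row≡0 a = sumℚ (λ j → if adj G a j then restrict j else 0ℚ) ≡ 0ℚ

      at-v : row≡0 v
      at-v = begin
        sumℚ (λ j → if adj G v j then restrict j else 0ℚ) ≡⟨ QS.∑-subset (adj G v) restrict ⟩
        sumℚ (restrict ∘ u)                               ≡⟨ QS.∑-cong (λ k → trans (restrict-u k) (sym (Yp≡Yu k))) ⟩
        sumℚ (Y ∘ p)                                      ≡⟨ ∑Yp≡0 ⟩
        0ℚ ∎

      at-old : ∀ a → ¬ a ≡ v → row≡0 a
      at-old a a≢v = trans (sym (QL.nbhd-old a≢v Y c Yq≡c)) (nbhd≡0 (old a))

    lift-restrict : ∀ κ → lift restrict κ ≡ Y κ
    lift-restrict (old a) = old-cases (λ a → lift restrict (old a) ≡ Y (old a)) at-v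
      (λ a a≢v → trans (lift-old restrict a≢v) (if-false (isV-other a≢v))) a
      where
      at-v : lift restrict (old v) ≡ Y (old v)
      at-v = begin
        lift restrict (old v)          ≡⟨ lift-v restrict ⟩
        restrict v - r · restrict v    ≡⟨ cong (λ t → t - r · t) (if-true isV-self) ⟩
        c - r · c                      ≡⟨ cong (c -_) (QS.∑-cong (sym ∘ Yq≡c)) ⟩
        c - sumℚ (Y ∘ q)               ≡⟨ solve 2 (λ a t → (a :+ t) :- t := a) refl (Y (old v)) (sumℚ (Y ∘ q)) ⟩
        Y (old v) ∎
    lift-restrict (p k) = trans (restrict-u k) (sym (Yp≡Yu k))
    lift-restrict (q k) = trans (if-true isV-self) (sym (Yq≡c k))

  lift-linear : ∀ {x x′ : Fin n → ℚ} (d : ℚ) → (∀ w → x′ w ≡ d * x w) → ∀ κ → lift x′ κ ≡ d * lift x κ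
  lift-linear {x} {x′} d x′≡dx (old w) = trans
    (cong₂ (if isV w then_else_) at-v (x′≡dx w))
    (sym (if-float (d *_) (isV w)))
    where
    at-v : x′ v - r · x′ v ≡ d * (x v - r · x v)
    at-v = begin
      x′ v - r · x′ v              ≡⟨ cong (λ t → t - r · t) (x′≡dx v) ⟩
      d * x v - r · (d * x v)      ≡⟨ cong (d * x v -_) (·-scale r d (x v)) ⟩
      d * x v - d * (r · x v)      ≡⟨ solve 3 (λ d a s → d :* a :- d :* s := d :* (a :- s)) refl d (x v) (r · x v) ⟩
      d * (x v - r · x v) ∎
  lift-linear d x′≡dx (p k) = x′≡dx (u k)
  lift-linear d x′≡dx (q k) = x′≡dx v

  lift-nonzero : ∀ x → (∀ w → ¬ x w ≡ 0ℚ) → ¬ r ≡ 1 → ∀ κ → ¬ lift x κ ≡ 0ℚ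
  lift-nonzero x x≢0 r≢1 (old a) = old-cases (λ a → ¬ lift x (old a) ≡ 0ℚ)
    (λ eq → minus-·-nonzero r (x≢0 v) r≢1 (trans (sym (lift-v x)) eq))
    (λ a a≢v eq → x≢0 a (trans (sym (lift-old x a≢v)) eq)) a
  lift-nonzero x x≢0 r≢1 (p k) = x≢0 (u k)
  lift-nonzero x x≢0 r≢1 (q k) = x≢0 v

  -- A nowhere-zero kernel vector rules out deg v = 1: the row of v would be a
  -- single nonzero entry.
  degree≢1 : ∀ x → InKernel G x → (∀ w → ¬ x w ≡ 0ℚ) → ¬ r ≡ 1
  degree≢1 x x∈ker x≢0 r≡1 = singleton-∑-nonzero (x ∘ u) r≡1 (x≢0 ∘ u) (kernel-row-v x x∈ker)

  expansion-nut : Nut G → Nut G'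
  expansion-nut nut@((x , x∈ker , _ , spans) , _) =
    (z , z∈ker , (index (old v) , z≢0 (index (old v))) , z-spans) , λ i → z , z∈ker , z≢0 i
    where
    x≢0 : ∀ w → ¬ x w ≡ 0ℚ
    x≢0 = nut-generator-nowhere-zero G nut

    z : Fin N → ℚ
    z = lift x ∘ kind

    z∈ker : InKernel G' z
    z∈ker = kernel-of-nbhd (lift x) (lift-kernel x x∈ker)

    z≢0 : ∀ i → ¬ z i ≡ 0ℚ
    z≢0 i = lift-nonzero x x≢0 (degree≢1 x x∈ker x≢0) (kind i)

    z-spans : ∀ y → InKernel G' y → ∃ λ d → ∀ i → y i ≡ d * z i
    z-spans y y∈ker = d , λ i → begin
      y i                      ≡⟨ cong y (sym (index-kind i)) ⟩
      y (index (kind i))       ≡⟨ sym (lift-restrict (kind i)) ⟩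
      lift restrict (kind i)   ≡⟨ lift-linear d restrict≡dx (kind i) ⟩
      d * z i ∎
      where
      open Restriction (y ∘ index) (nbhd-of-kernel y y∈ker)
      d : ℚ
      d = proj₁ (spans restrict restrict-kernel)
      restrict≡dx : ∀ w → restrict w ≡ d * x w
      restrict≡dx = proj₂ (spans restrict restrict-kernel)

module ExpansionDegree {n : ℕ} (G : Graph n) (v : Fin n) where
  open Expansion G v
  open import Data.Nat using (_+_)
  module NS = FiniteSum ℕ-sums
  module NL = Local ℕ-sums

  -- The expansion preserves k-regularity: v keeps degree r, each p i and q i
  -- gets degree 1 + (r - 1), and every other vertex keeps its degree.
  expansion-regular : Regular G → Regular G'
  expansion-regular (k , deg≡k) = k , λ i → trans (NL.nbhd-G' (λ _ → 1) i) (vertex-degree (kind i))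
    where
    r≡k : sumℕ {r} (λ _ → 1) ≡ k
    r≡k = trans (sym (NS.∑-subset (adj G v) (λ _ → 1))) (deg≡k v)

    new-degree : ∀ i → 1 + NS.∑-except i (λ _ → 1) ≡ k
    new-degree i = trans (ℕP.+-comm 1 _) (trans (NS.∑-except-∙ i (λ _ → 1)) r≡k)

    vertex-degree : ∀ κ → NL.nbhd κ (λ _ → 1) ≡ k
    vertex-degree (old a) = old-cases (λ a → NL.nbhd (old a) (λ _ → 1) ≡ k)
      (trans (NL.nbhd-v (λ _ → 1)) r≡k)
      (λ a a≢v → trans (NL.nbhd-old a≢v (λ _ → 1) 1 (λ _ → refl))
                (trans (NS.∑-cong (λ w → cong (if adj G a w then_else 0) (if-eta (isV w)))) (deg≡k a))) a
    vertex-degree (p i) = trans (NL.nbhd-p (λ _ → 1) i) (new-degree i)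
    vertex-degree (q i) = trans (NL.nbhd-q (λ _ → 1) i) (new-degree i)

open import Data.Nat using (_+_; _*_)

corollary1 : (n : ℕ) (G : Graph n) → Nut G → (v : Fin n) (ρ : ℕ) → degree G v ≡ ρ →
    (Σ (Graph (n + 2 * ρ)) λ G' → Nut G') ×
    (Regular G → Σ (Graph (n + 2 * ρ)) λ G' → Nut G' × Regular G')
corollary1 n G nut v .(degree G v) refl =
  (G' , expansion-nut nut) , λ regular → G' , expansion-nut nut , expansion-regular regular
  where
  open Expansion G v using (G')
  open ExpansionKernel G v using (expansion-nut)
  open ExpansionDegree G v using (expansion-regular)
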